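{- Let $1\le k_1<k_2<\cdots<k_s$ be integers, $r=\lfloor\log_2(k_s)\rfloor+1$, and $$c_0(k_1,\dots,k_s)=\frac{1}{2^r}\sum_{m=0}^{2^r-1}(-1)^{\binom{m}{k_1}+\cdots+\binom{m}{k_s}}.$$ Then $$c_0(k_1,\dots,k_s)=1-\sum_{i=1}^s2^{1-w_2(k_i)}+\sum_{i_1<i_2}2^{2-w_2(k_{i_1}\vee k_{i_2})}-\sum_{i_1<i_2<i_3}2^{3-w_2(k_{i_1}\vee k_{i_2}\vee k_{i_3})}+\cdots+(-1)^s2^{s-w_2(k_1\vee k_2\vee\cdots\vee k_s)},$$ i.e. $c_0(k_1,\dots,k_s)=1+\sum_{j=1}^s(-1)^j\sum_{1\le i_1<\cdots<i_j\le s}2^{\,j-w_2(k_{i_1}\vee\cdots\vee k_{i_j})}$.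
   Context: $w_2(k)$ is the sum of the binary digits of $k$. For natural numbers $m,n$, $m\vee n$ is the bitwise OR of their binary digits (e.g. $3\vee8=11$). The quantity $c_0(k_1,\dots,k_s)$ equals $\lim_{n\to\infty}2^{ -n}\sum_{j=0}^n(-1)^{\binom{j}{k_1}+\cdots+\binom{j}{k_s}}\binom{n}{j}$, the limiting correlation of the symmetric Boolean function $\sigma_{n,k_1}+\cdots+\sigma_{n,k_s}$. -}

module Defs where

open import Data.Nat as ℕ using (ℕ; zero; suc; _+_; _*_; _^_; _⊔_; _/_; _%_)
open import Data.Nat.Combinatorics using (_C_)
open import Data.Nat.ListAction using (sum)
open import Data.Nat.Logarithm using (⌊log₂_⌋)
open import Data.Integer as ℤ using (ℤ; +_; -[1+_])
open import Data.Rational as ℚ using (ℚ; 0ℚ; 1ℚ; ½)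
open import Data.List using (List; []; _∷_; map; foldr; upTo; length)
open import Data.List.NonEmpty as L⁺ using (List⁺; toList)

-- Binary digit sum w₂(k), computed with fuel (k halvings always suffice).
w₂-fuel : ℕ → ℕ → ℕ
w₂-fuel zero    n = 0
w₂-fuel (suc f) n = n % 2 + w₂-fuel f (n / 2)

w₂ : ℕ → ℕ
w₂ n = w₂-fuel n n

-- Bitwise OR m ∨ n, computed with fuel (m + n halvings always suffice).
or-fuel : ℕ → ℕ → ℕ → ℕ
or-fuel zero    m n = 0
or-fuel (suc f) m n = ((m % 2) ⊔ (n % 2)) + 2 * or-fuel f (m / 2) (n / 2)

_∨_ : ℕ → ℕ → ℕ
m ∨ n = or-fuel (m + n) m n

infixl 6 _∨_

⋁ : List ℕ → ℕ
⋁ = foldr _∨_ 0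

Σℚ : List ℚ → ℚ
Σℚ = foldr ℚ._+_ 0ℚ

sgn : ℕ → ℚ
sgn n with n % 2
... | zero  = 1ℚ
... | suc _ = ℚ.- 1ℚ

powℚ : ℚ → ℕ → ℚ
powℚ q zero    = 1ℚ
powℚ q (suc n) = q ℚ.* powℚ q n

pow2 : ℤ → ℚ
pow2 (+ n)    = powℚ (1ℚ ℚ.+ 1ℚ) n
pow2 -[1+ n ] = powℚ ½ (suc n)

-- all sub-lists of xs of length j, preserving order
-- (i.e. the tuples (x_{i₁},…,x_{i_j}) with i₁ < ⋯ < i_j)
choose : ℕ → List ℕ → List (List ℕ)
choose zero    xs       = [] ∷ []
choose (suc j) []       = []
choose (suc j) (x ∷ xs) = map (x ∷_) (choose j xs) Data.List.++ choose (suc j) xs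

rOf : List⁺ ℕ → ℕ
rOf ks = suc ⌊log₂ L⁺.last ks ⌋

c₀ : List⁺ ℕ → ℚ
c₀ ks = powℚ ½ (rOf ks) ℚ.*
  Σℚ (map (λ m → sgn (sum (map (m C_) (toList ks)))) (upTo (2 ^ rOf ks)))

rhs : List⁺ ℕ → ℚ
rhs ks = 1ℚ ℚ.+ Σℚ (map term (Data.List.map suc (upTo s)))
  where
  s = length (toList ks)
  term : ℕ → ℚ
  term j = sgn j ℚ.* Σℚ (map (λ I → pow2 (+ j ℤ.- + w₂ (⋁ I))) (choose j (toList ks)))

{-# OPTIONS --safe #-}

-- By Lucas' theorem for p = 2, C(m,k) is odd iff the binary digits of k are among those of m.
-- Hence (-1)^C(m,k) = 1 - 2·[k ⊆ m], and [k ⊆ m][k' ⊆ m] = [k ∨ k' ⊆ m], so expanding the product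
-- ∏ᵢ (1 - 2·[kᵢ ⊆ m]) gives Σ_{I} (-2)^|I| [⋁ I ⊆ m].  Averaging over m < 2^r, where every ⋁ I
-- still lies below 2^r, the density of the m containing the digits of K is 2^(-w₂ K); grouping the
-- I by size turns (-2)^|I| 2^(-w₂ ⋁I) into the alternating terms (-1)^j 2^(j - w₂ ⋁I).

module Submission where

open import Defs
open import Algebra.Properties.CommutativeSemigroup as ℙ-CommSemigroup using ()
open import Data.Bool.Base using (Bool; true; false) renaming (_∨_ to _∨ᵇ_)
open import Data.Integer as ℤ using (_⊖_)
import Data.Integer.Properties as ℤ
open import Data.List.Base using (List; []; _∷_; _++_; map; upTo; applyUpTo; length)
import Data.List.Base as List
import Data.List.Properties as List
open import Data.List.NonEmpty.Base as List⁺ using (List⁺; toList; _∷ʳ′_)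
import Data.List.Relation.Unary.All as All
open import Data.List.Relation.Unary.All using (All; []; _∷_)
import Data.List.Relation.Unary.All.Properties as All
open import Data.List.Relation.Unary.AllPairs using (AllPairs; []; _∷_)
open import Data.Nat.Base
  using (ℕ; zero; suc; _+_; _*_; _^_; _⊔_; _%_; _/_; _≤_; _<_; z≤n; s≤s; parity)
open import Data.Nat.Properties
  using (≤-refl; ≤-trans; <-trans; <-≤-trans; <⇒≤pred; ≰⇒>; 1+n≰n; n<1+n;
         m≤m+n; m≤n+m; +-monoˡ-≤; *-monoʳ-≤; *-suc; *-comm; m^n>0)
open import Data.Nat.DivMod using (m/n<m; m/n≡1+[m∸n]/n; m<n*o⇒m/o<n)
open import Data.Nat.Combinatorics using (_C_; nCk+nC[k+1]≡[n+1]C[k+1])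
open import Data.Nat.ListAction using (sum)
open import Data.Nat.Logarithm using (⌊log₂_⌋; ⌊log₂⌋-mono-≤; ⌊log₂[2^n]⌋≡n)
open import Data.Parity.Base as ℙ using (Parity; 0ℙ; 1ℙ)
import Data.Parity.Properties as ℙ
open import Data.Product using (proj₂)
open import Data.Rational as ℚ using (ℚ; 0ℚ; 1ℚ; ½)
import Data.Rational.Properties as ℚ
open import Data.Rational.Solver using (module +-*-Solver)
open +-*-Solver
open import Relation.Binary.PropositionalEquality
open ≡-Reasoning

open ℙ-CommSemigroup ℙ.*-commutativeSemigroup using (interchange)

double : ℕ → ℕ
double zero    = zero
double (suc n) = suc (suc (double n))

double≡2* : ∀ n → double n ≡ 2 * n
double≡2* zero    = refl
double≡2* (suc n) = trans (cong (λ m → suc (suc m)) (double≡2* n)) (sym (*-suc 2 n))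

bit : Bool → ℕ
bit false = 0
bit true  = 1

pushBit : Bool → ℕ → ℕ
pushBit false a = double a
pushBit true  a = suc (double a)

pushBit≡bit+2* : ∀ b a → pushBit b a ≡ bit b + 2 * a
pushBit≡bit+2* false a = double≡2* a
pushBit≡bit+2* true  a = cong suc (double≡2* a)

data Binary : ℕ → Set where
  _∷ᵇ_ : ∀ b a → Binary (pushBit b a)

binary : ∀ n → Binary n
binary zero = false ∷ᵇ zero
binary (suc n) with binary n
... | false ∷ᵇ a = true ∷ᵇ a
... | true  ∷ᵇ a = false ∷ᵇ suc a

pushBit%2 : ∀ b a → pushBit b a % 2 ≡ bit b
pushBit%2 false zero    = refl
pushBit%2 true  zero    = refl
pushBit%2 false (suc a) = pushBit%2 false a
pushBit%2 true  (suc a) = pushBit%2 true a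

pushBit/2 : ∀ b a → pushBit b a / 2 ≡ a
pushBit/2 false zero    = refl
pushBit/2 true  zero    = refl
pushBit/2 false (suc a) = trans (m/n≡1+[m∸n]/n {double (suc a)} (s≤s (s≤s z≤n))) (cong suc (pushBit/2 false a))
pushBit/2 true  (suc a) = trans (m/n≡1+[m∸n]/n {suc (double (suc a))} (s≤s (s≤s z≤n))) (cong suc (pushBit/2 true a))

n≤1+f⇒n/2≤f : ∀ n f → n ≤ suc f → n / 2 ≤ f
n≤1+f⇒n/2≤f zero    f _ = z≤n
n≤1+f⇒n/2≤f (suc n) f n≤1+f = <⇒≤pred (<-≤-trans (m/n<m (suc n) 2 (s≤s (s≤s z≤n))) n≤1+f)

pushBit≤1+f⇒≤f : ∀ b a f → pushBit b a ≤ suc f → a ≤ f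
pushBit≤1+f⇒≤f b a f p = subst (_≤ f) (pushBit/2 b a) (n≤1+f⇒n/2≤f (pushBit b a) f p)

pushBit-< : ∀ b {a n} → a < n → pushBit b a < 2 * n
pushBit-< b {a} {n} a<n rewrite pushBit≡bit+2* b a =
  ≤-trans (s≤s (+-monoˡ-≤ (2 * a) (bit≤1 b))) (subst (_≤ 2 * n) (*-suc 2 a) (*-monoʳ-≤ 2 a<n))
  where
  bit≤1 : ∀ b → bit b ≤ 1
  bit≤1 false = z≤n
  bit≤1 true  = ≤-refl

pushBit-<⁻¹ : ∀ b {a n} → pushBit b a < 2 * n → a < n
pushBit-<⁻¹ b {a} {n} p =
  subst (_< n) (pushBit/2 b a) (m<n*o⇒m/o<n (subst (pushBit b a <_) (*-comm 2 n) p))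

w₂-fuel-irrelevant : ∀ f g n → n ≤ f → n ≤ g → w₂-fuel f n ≡ w₂-fuel g n
w₂-fuel-irrelevant zero    zero    zero _ _ = refl
w₂-fuel-irrelevant zero    (suc g) zero _ _ = w₂-fuel-irrelevant zero g zero z≤n z≤n
w₂-fuel-irrelevant (suc f) zero    zero _ _ = w₂-fuel-irrelevant f zero zero z≤n z≤n
w₂-fuel-irrelevant (suc f) (suc g) n n≤f n≤g =
  cong ((n % 2) +_) (w₂-fuel-irrelevant f g (n / 2) (n≤1+f⇒n/2≤f n f n≤f) (n≤1+f⇒n/2≤f n g n≤g))

w₂-unfold : ∀ n → w₂ n ≡ n % 2 + w₂ (n / 2)
w₂-unfold zero    = refl
w₂-unfold (suc n) =
  cong ((suc n % 2) +_) (w₂-fuel-irrelevant n (suc n / 2) _ (n≤1+f⇒n/2≤f (suc n) n ≤-refl) ≤-refl)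

w₂-pushBit : ∀ b a → w₂ (pushBit b a) ≡ bit b + w₂ a
w₂-pushBit b a = trans (w₂-unfold (pushBit b a)) (cong₂ _+_ (pushBit%2 b a) (cong w₂ (pushBit/2 b a)))

or-fuel-irrelevant : ∀ f g m n → m ≤ f → n ≤ f → m ≤ g → n ≤ g → or-fuel f m n ≡ or-fuel g m n
or-fuel-irrelevant zero    zero    zero zero _ _ _ _ = refl
or-fuel-irrelevant zero    (suc g) zero zero _ _ _ _ = cong (2 *_) (or-fuel-irrelevant zero g 0 0 z≤n z≤n z≤n z≤n)
or-fuel-irrelevant (suc f) zero    zero zero _ _ _ _ = cong (2 *_) (or-fuel-irrelevant f zero 0 0 z≤n z≤n z≤n z≤n)
or-fuel-irrelevant (suc f) (suc g) m n m≤f n≤f m≤g n≤g =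
  cong (λ z → (m % 2 ⊔ n % 2) + 2 * z)
    (or-fuel-irrelevant f g (m / 2) (n / 2)
      (n≤1+f⇒n/2≤f m f m≤f) (n≤1+f⇒n/2≤f n f n≤f) (n≤1+f⇒n/2≤f m g m≤g) (n≤1+f⇒n/2≤f n g n≤g))

or-fuel-unfold : ∀ f m n → m ≤ suc f → n ≤ suc f →
  or-fuel (suc f) m n ≡ (m % 2 ⊔ n % 2) + 2 * (m / 2 ∨ n / 2)
or-fuel-unfold f m n m≤ n≤ = cong (λ z → (m % 2 ⊔ n % 2) + 2 * z)
  (or-fuel-irrelevant f (m / 2 + n / 2) (m / 2) (n / 2)
    (n≤1+f⇒n/2≤f m f m≤) (n≤1+f⇒n/2≤f n f n≤) (m≤m+n (m / 2) (n / 2)) (m≤n+m (n / 2) (m / 2)))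

∨-unfold : ∀ m n → m ∨ n ≡ (m % 2 ⊔ n % 2) + 2 * (m / 2 ∨ n / 2)
∨-unfold zero    zero    = refl
∨-unfold (suc m) n       = or-fuel-unfold (m + n) (suc m) n (s≤s (m≤m+n m n)) (m≤n+m n (suc m))
∨-unfold zero    (suc n) = or-fuel-unfold n zero (suc n) z≤n ≤-refl

∨-pushBit : ∀ b a c d → pushBit b a ∨ pushBit c d ≡ pushBit (b ∨ᵇ c) (a ∨ d)
∨-pushBit b a c d = begin
  pushBit b a ∨ pushBit c d
    ≡⟨ ∨-unfold (pushBit b a) (pushBit c d) ⟩
  (pushBit b a % 2 ⊔ pushBit c d % 2) + 2 * (pushBit b a / 2 ∨ pushBit c d / 2)
    ≡⟨ cong₂ (λ u v → u + 2 * v) (cong₂ _⊔_ (pushBit%2 b a) (pushBit%2 c d))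
                                  (cong₂ _∨_ (pushBit/2 b a) (pushBit/2 c d)) ⟩
  (bit b ⊔ bit c) + 2 * (a ∨ d)
    ≡⟨ cong (_+ 2 * (a ∨ d)) (bit-⊔ b c) ⟩
  bit (b ∨ᵇ c) + 2 * (a ∨ d)
    ≡⟨ pushBit≡bit+2* (b ∨ᵇ c) (a ∨ d) ⟨
  pushBit (b ∨ᵇ c) (a ∨ d) ∎
  where
  bit-⊔ : ∀ b c → bit b ⊔ bit c ≡ bit (b ∨ᵇ c)
  bit-⊔ false false = refl
  bit-⊔ false true  = refl
  bit-⊔ true  false = refl
  bit-⊔ true  true  = refl

∨-<-2^ : ∀ r {m n} → m < 2 ^ r → n < 2 ^ r → m ∨ n < 2 ^ r
∨-<-2^ zero    (s≤s z≤n) (s≤s z≤n) = s≤s z≤n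
∨-<-2^ (suc r) {m} {n} m< n< with binary m | binary n
... | b ∷ᵇ a | c ∷ᵇ d rewrite ∨-pushBit b a c d =
  pushBit-< (b ∨ᵇ c) (∨-<-2^ r (pushBit-<⁻¹ b m<) (pushBit-<⁻¹ c n<))

n<2^[1+⌊log₂n⌋] : ∀ n → n < 2 ^ suc ⌊log₂ n ⌋
n<2^[1+⌊log₂n⌋] n = ≰⇒> λ 2^≤n →
  1+n≰n (subst (_≤ ⌊log₂ n ⌋) (⌊log₂[2^n]⌋≡n (suc ⌊log₂ n ⌋)) (⌊log₂⌋-mono-≤ 2^≤n))

-- Lucas' theorem modulo 2

-- Binomial coefficients by Pascal's rule, so that the parity recursions below hold definitionally.
pascal : ℕ → ℕ → ℕ
pascal n       zero    = 1
pascal zero    (suc k) = 0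
pascal (suc n) (suc k) = pascal n k + pascal n (suc k)

pascal≡C : ∀ n k → pascal n k ≡ n C k
pascal≡C n       zero    = refl
pascal≡C zero    (suc k) = refl
pascal≡C (suc n) (suc k) =
  trans (cong₂ _+_ (pascal≡C n k) (pascal≡C n (suc k))) (nCk+nC[k+1]≡[n+1]C[k+1] n k)

parity-+-cancel-middle : ∀ p q r → parity ((p + q) + (q + r)) ≡ parity p ℙ.+ parity r
parity-+-cancel-middle p q r = begin
  parity ((p + q) + (q + r))          ≡⟨ ℙ.+-homo-+ (p + q) (q + r) ⟩
  parity (p + q) ℙ.+ parity (q + r)   ≡⟨ cong₂ ℙ._+_ (ℙ.+-homo-+ p q) (ℙ.+-homo-+ q r) ⟩
  (P ℙ.+ Q) ℙ.+ (Q ℙ.+ R)             ≡⟨ ℙ.+-assoc P Q (Q ℙ.+ R) ⟩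
  P ℙ.+ (Q ℙ.+ (Q ℙ.+ R))             ≡⟨ cong (P ℙ.+_) (ℙ.+-assoc Q Q R) ⟨
  P ℙ.+ ((Q ℙ.+ Q) ℙ.+ R)             ≡⟨ cong (λ z → P ℙ.+ (z ℙ.+ R)) (ℙ.p+p≡0ℙ Q) ⟩
  P ℙ.+ R                             ∎
  where
  P Q R : Parity
  P = parity p
  Q = parity q
  R = parity r

mutual
  parity-pascal-even-even : ∀ a c → parity (pascal (double a) (double c)) ≡ parity (pascal a c)
  parity-pascal-even-even a       zero    = refl
  parity-pascal-even-even zero    (suc c) = refl
  parity-pascal-even-even (suc a) (suc c) = begin
    parity (pascal (suc (suc (double a))) (suc (suc (double c))))
      ≡⟨ parity-+-cancel-middle (pascal (double a) (double c)) (pascal (double a) (suc (double c)))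
           (pascal (double a) (double (suc c))) ⟩
    parity (pascal (double a) (double c)) ℙ.+ parity (pascal (double a) (double (suc c)))
      ≡⟨ cong₂ ℙ._+_ (parity-pascal-even-even a c) (parity-pascal-even-even a (suc c)) ⟩
    parity (pascal a c) ℙ.+ parity (pascal a (suc c))
      ≡⟨ ℙ.+-homo-+ (pascal a c) (pascal a (suc c)) ⟨
    parity (pascal (suc a) (suc c)) ∎

  parity-pascal-even-odd : ∀ a c → parity (pascal (double a) (suc (double c))) ≡ 0ℙ
  parity-pascal-even-odd zero    c       = refl
  parity-pascal-even-odd (suc a) zero    = parity-pascal-even-odd a zero
  parity-pascal-even-odd (suc a) (suc c) =
    trans (parity-+-cancel-middle (pascal (double a) (suc (double c))) (pascal (double a) (double (suc c)))
             (pascal (double a) (suc (double (suc c)))))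
          (cong₂ ℙ._+_ (parity-pascal-even-odd a c) (parity-pascal-even-odd a (suc c)))

parity-pascal-odd-even : ∀ a c → parity (pascal (suc (double a)) (double c)) ≡ parity (pascal a c)
parity-pascal-odd-even a zero    = refl
parity-pascal-odd-even a (suc c) =
  trans (ℙ.+-homo-+ (pascal (double a) (suc (double c))) _)
        (cong₂ ℙ._+_ (parity-pascal-even-odd a c) (parity-pascal-even-even a (suc c)))

parity-pascal-odd-odd : ∀ a c → parity (pascal (suc (double a)) (suc (double c))) ≡ parity (pascal a c)
parity-pascal-odd-odd a c = begin
  parity (pascal (double a) (double c) + pascal (double a) (suc (double c)))
    ≡⟨ ℙ.+-homo-+ (pascal (double a) (double c)) _ ⟩
  parity (pascal (double a) (double c)) ℙ.+ parity (pascal (double a) (suc (double c)))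
    ≡⟨ cong₂ ℙ._+_ (parity-pascal-even-even a c) (parity-pascal-even-odd a c) ⟩
  parity (pascal a c) ℙ.+ 0ℙ
    ≡⟨ ℙ.+-identityʳ _ ⟩
  parity (pascal a c) ∎

parity-C-pushBit : ∀ b a c d →
  parity (pushBit b a C pushBit c d) ≡ parity (bit b C bit c) ℙ.* parity (a C d)
parity-C-pushBit b a c d
  rewrite sym (pascal≡C (pushBit b a) (pushBit c d)) | sym (pascal≡C (bit b) (bit c)) | sym (pascal≡C a d)
  = lucas b c
  where
  lucas : ∀ b c → parity (pascal (pushBit b a) (pushBit c d)) ≡ parity (pascal (bit b) (bit c)) ℙ.* parity (pascal a d)
  lucas false false = parity-pascal-even-even a d
  lucas false true  = parity-pascal-even-odd a d
  lucas true  false = parity-pascal-odd-even a d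
  lucas true  true  = parity-pascal-odd-odd a d

parity-C-bit-∨ : ∀ b c e → parity (bit b C bit (c ∨ᵇ e)) ≡ parity (bit b C bit c) ℙ.* parity (bit b C bit e)
parity-C-bit-∨ false false e     = refl
parity-C-bit-∨ false true  e     = refl
parity-C-bit-∨ true  false e     = refl
parity-C-bit-∨ true  true  false = refl
parity-C-bit-∨ true  true  true  = refl

parity-C-∨ : ∀ m k x → parity (m C (k ∨ x)) ≡ parity (m C k) ℙ.* parity (m C x)
parity-C-∨ m k x = go (m + k + x) m k x
  (≤-trans (m≤m+n m k) (m≤m+n (m + k) x)) (≤-trans (m≤n+m k m) (m≤m+n (m + k) x)) (m≤n+m x (m + k))
  where
  go : ∀ f m k x → m ≤ f → k ≤ f → x ≤ f → parity (m C (k ∨ x)) ≡ parity (m C k) ℙ.* parity (m C x)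
  go zero    .0 .0 .0 z≤n z≤n z≤n = refl
  go (suc f) m  k  x  m≤ k≤ x≤ with binary m | binary k | binary x
  ... | b ∷ᵇ a | c ∷ᵇ d | e ∷ᵇ y = begin
    parity (pushBit b a C (pushBit c d ∨ pushBit e y))
      ≡⟨ cong (λ z → parity (pushBit b a C z)) (∨-pushBit c d e y) ⟩
    parity (pushBit b a C pushBit (c ∨ᵇ e) (d ∨ y))
      ≡⟨ parity-C-pushBit b a (c ∨ᵇ e) (d ∨ y) ⟩
    parity (bit b C bit (c ∨ᵇ e)) ℙ.* parity (a C (d ∨ y))
      ≡⟨ cong₂ ℙ._*_ (parity-C-bit-∨ b c e)
           (go f a d y (pushBit≤1+f⇒≤f b a f m≤) (pushBit≤1+f⇒≤f c d f k≤) (pushBit≤1+f⇒≤f e y f x≤)) ⟩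
    (parity (bit b C bit c) ℙ.* parity (bit b C bit e)) ℙ.* (parity (a C d) ℙ.* parity (a C y))
      ≡⟨ interchange (parity (bit b C bit c)) (parity (bit b C bit e)) (parity (a C d)) (parity (a C y)) ⟩
    (parity (bit b C bit c) ℙ.* parity (a C d)) ℙ.* (parity (bit b C bit e) ℙ.* parity (a C y))
      ≡⟨ cong₂ ℙ._*_ (parity-C-pushBit b a c d) (parity-C-pushBit b a e y) ⟨
    parity (pushBit b a C pushBit c d) ℙ.* parity (pushBit b a C pushBit e y) ∎

two : ℚ
two = 1ℚ ℚ.+ 1ℚ

sign : Parity → ℚ
sign 0ℙ = 1ℚ
sign 1ℙ = ℚ.- 1ℚ

toℚ : Parity → ℚ
toℚ 0ℙ = 0ℚ
toℚ 1ℙ = 1ℚ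

sign-+ : ∀ p q → sign (p ℙ.+ q) ≡ sign p ℚ.* sign q
sign-+ 0ℙ 0ℙ = refl
sign-+ 0ℙ 1ℙ = refl
sign-+ 1ℙ 0ℙ = refl
sign-+ 1ℙ 1ℙ = refl

toℚ-* : ∀ p q → toℚ (p ℙ.* q) ≡ toℚ p ℚ.* toℚ q
toℚ-* 0ℙ 0ℙ = refl
toℚ-* 0ℙ 1ℙ = refl
toℚ-* 1ℙ 0ℙ = refl
toℚ-* 1ℙ 1ℙ = refl

sign≡1-2toℚ : ∀ p → sign p ≡ 1ℚ ℚ.+ ℚ.- two ℚ.* toℚ p
sign≡1-2toℚ 0ℙ = refl
sign≡1-2toℚ 1ℙ = refl

sgn≡sign∘parity : ∀ n → sgn n ≡ sign (parity n)
sgn≡sign∘parity zero          = refl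
sgn≡sign∘parity (suc zero)    = refl
sgn≡sign∘parity (suc (suc n)) = sgn≡sign∘parity n

sgn-+ : ∀ m n → sgn (m + n) ≡ sgn m ℚ.* sgn n
sgn-+ m n = begin
  sgn (m + n)                     ≡⟨ sgn≡sign∘parity (m + n) ⟩
  sign (parity (m + n))           ≡⟨ cong sign (ℙ.+-homo-+ m n) ⟩
  sign (parity m ℙ.+ parity n)    ≡⟨ sign-+ (parity m) (parity n) ⟩
  sign (parity m) ℚ.* sign (parity n) ≡⟨ cong₂ ℚ._*_ (sgn≡sign∘parity m) (sgn≡sign∘parity n) ⟨
  sgn m ℚ.* sgn n                 ∎

sgn-*-two^ : ∀ j → sgn j ℚ.* powℚ two j ≡ powℚ (ℚ.- two) j
sgn-*-two^ zero          = refl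
sgn-*-two^ (suc zero)    = refl
sgn-*-two^ (suc (suc j)) =
  trans (solve 3 (λ s t p → s :* (t :* (t :* p)) := (:- t) :* ((:- t) :* (s :* p))) refl (sgn j) two (powℚ two j))
        (cong (λ z → ℚ.- two ℚ.* (ℚ.- two ℚ.* z)) (sgn-*-two^ j))

powℚ-+ : ∀ q m n → powℚ q (m + n) ≡ powℚ q m ℚ.* powℚ q n
powℚ-+ q zero    n = sym (ℚ.*-identityˡ (powℚ q n))
powℚ-+ q (suc m) n = trans (cong (q ℚ.*_) (powℚ-+ q m n)) (sym (ℚ.*-assoc q (powℚ q m) (powℚ q n)))

pow2-∸ : ∀ j w → pow2 (ℤ.+ j ℤ.- ℤ.+ w) ≡ powℚ two j ℚ.* powℚ ½ w
pow2-∸ j w = trans (cong pow2 (ℤ.m-n≡m⊖n j w)) (pow2-⊖ j w)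
  where
  pow2-⊖ : ∀ j w → pow2 (j ⊖ w) ≡ powℚ two j ℚ.* powℚ ½ w
  pow2-⊖ j       zero    = sym (ℚ.*-identityʳ _)
  pow2-⊖ zero    (suc w) = sym (ℚ.*-identityˡ _)
  pow2-⊖ (suc j) (suc w) = begin
    pow2 (suc j ⊖ suc w)                           ≡⟨ cong pow2 (ℤ.[1+m]⊖[1+n]≡m⊖n j w) ⟩
    pow2 (j ⊖ w)                                   ≡⟨ pow2-⊖ j w ⟩
    powℚ two j ℚ.* powℚ ½ w                        ≡⟨ ℚ.*-identityˡ _ ⟨
    (two ℚ.* ½) ℚ.* (powℚ two j ℚ.* powℚ ½ w)
      ≡⟨ solve 4 (λ t h a b → (t :* h) :* (a :* b) := (t :* a) :* (h :* b)) refl two ½ (powℚ two j) (powℚ ½ w) ⟩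
    powℚ two (suc j) ℚ.* powℚ ½ (suc w)            ∎

sumTo : ℕ → (ℕ → ℚ) → ℚ
sumTo zero    f = 0ℚ
sumTo (suc n) f = f 0 ℚ.+ sumTo n (λ i → f (suc i))

sumTo-cong : ∀ n {f g} → (∀ i → f i ≡ g i) → sumTo n f ≡ sumTo n g
sumTo-cong zero    f≗g = refl
sumTo-cong (suc n) f≗g = cong₂ ℚ._+_ (f≗g 0) (sumTo-cong n (λ i → f≗g (suc i)))

sumTo-distrib-+ : ∀ n f g → sumTo n (λ i → f i ℚ.+ g i) ≡ sumTo n f ℚ.+ sumTo n g
sumTo-distrib-+ zero    f g = refl
sumTo-distrib-+ (suc n) f g = trans
  (cong (f 0 ℚ.+ g 0 ℚ.+_) (sumTo-distrib-+ n (λ i → f (suc i)) (λ i → g (suc i))))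
  (solve 4 (λ a b c d → (a :+ b) :+ (c :+ d) := (a :+ c) :+ (b :+ d)) refl
     (f 0) (g 0) (sumTo n (λ i → f (suc i))) (sumTo n (λ i → g (suc i))))

*-distribˡ-sumTo : ∀ n c f → c ℚ.* sumTo n f ≡ sumTo n (λ i → c ℚ.* f i)
*-distribˡ-sumTo zero    c f = ℚ.*-zeroʳ c
*-distribˡ-sumTo (suc n) c f =
  trans (ℚ.*-distribˡ-+ c (f 0) _) (cong (c ℚ.* f 0 ℚ.+_) (*-distribˡ-sumTo n c (λ i → f (suc i))))

sumTo-suc-vanishing : ∀ n f → f n ≡ 0ℚ → sumTo (suc n) f ≡ sumTo n f
sumTo-suc-vanishing zero    f f0≡0 = cong (ℚ._+ 0ℚ) f0≡0
sumTo-suc-vanishing (suc n) f fn≡0 = cong (f 0 ℚ.+_) (sumTo-suc-vanishing n (λ i → f (suc i)) fn≡0)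

sumTo-2* : ∀ n f → sumTo (2 * n) f ≡ sumTo n (λ a → f (pushBit false a) ℚ.+ f (pushBit true a))
sumTo-2* n f = subst (λ N → sumTo N f ≡ sumTo n (λ a → f (pushBit false a) ℚ.+ f (pushBit true a))) (double≡2* n) (sumTo-double n f)
  where
  sumTo-double : ∀ n f → sumTo (double n) f ≡ sumTo n (λ a → f (pushBit false a) ℚ.+ f (pushBit true a))
  sumTo-double zero    f = refl
  sumTo-double (suc n) f =
    trans (sym (ℚ.+-assoc (f 0) (f 1) _)) (cong (f 0 ℚ.+ f 1 ℚ.+_) (sumTo-double n (λ i → f (suc (suc i)))))

Σℚ-map-applyUpTo : ∀ n (f : ℕ → ℚ) g → Σℚ (map f (applyUpTo g n)) ≡ sumTo n (λ i → f (g i))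
Σℚ-map-applyUpTo zero    f g = refl
Σℚ-map-applyUpTo (suc n) f g = cong (f (g 0) ℚ.+_) (Σℚ-map-applyUpTo n f (λ i → g (suc i)))

Σℚ-++ : ∀ xs ys → Σℚ (xs ++ ys) ≡ Σℚ xs ℚ.+ Σℚ ys
Σℚ-++ []       ys = sym (ℚ.+-identityˡ _)
Σℚ-++ (x ∷ xs) ys = trans (cong (x ℚ.+_) (Σℚ-++ xs ys)) (sym (ℚ.+-assoc x _ _))

*-distribˡ-Σℚ-map : ∀ {A : Set} c (f : A → ℚ) xs → c ℚ.* Σℚ (map f xs) ≡ Σℚ (map (λ x → c ℚ.* f x) xs)
*-distribˡ-Σℚ-map c f []       = ℚ.*-zeroʳ c
*-distribˡ-Σℚ-map c f (x ∷ xs) =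
  trans (ℚ.*-distribˡ-+ c (f x) _) (cong (c ℚ.* f x ℚ.+_) (*-distribˡ-Σℚ-map c f xs))

-- Density of odd binomial coefficients

oddBinomialDensity : ∀ r K → K < 2 ^ r →
  powℚ ½ r ℚ.* sumTo (2 ^ r) (λ m → toℚ (parity (m C K))) ≡ powℚ ½ (w₂ K)
oddBinomialDensity zero    .0 (s≤s z≤n) = refl
oddBinomialDensity (suc r) K  K< with binary K
... | c ∷ᵇ a = begin
  ½ ℚ.* powℚ ½ r ℚ.* sumTo (2 * 2 ^ r) (λ m → odd (m C pushBit c a))
    ≡⟨ cong (½ ℚ.* powℚ ½ r ℚ.*_) (sumTo-2* (2 ^ r) _) ⟩
  ½ ℚ.* powℚ ½ r ℚ.* sumTo (2 ^ r) (λ m → odd (pushBit false m C pushBit c a) ℚ.+ odd (pushBit true m C pushBit c a))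
    ≡⟨ cong (½ ℚ.* powℚ ½ r ℚ.*_) (sumTo-cong (2 ^ r) digitSum) ⟩
  ½ ℚ.* powℚ ½ r ℚ.* sumTo (2 ^ r) (λ m → κ ℚ.* odd (m C a))
    ≡⟨ cong (½ ℚ.* powℚ ½ r ℚ.*_) (*-distribˡ-sumTo (2 ^ r) κ _) ⟨
  ½ ℚ.* powℚ ½ r ℚ.* (κ ℚ.* S)
    ≡⟨ solve 4 (λ h p k s → h :* p :* (k :* s) := (h :* k) :* (p :* s)) refl ½ (powℚ ½ r) κ S ⟩
  (½ ℚ.* κ) ℚ.* (powℚ ½ r ℚ.* S)
    ≡⟨ cong₂ ℚ._*_ (½*κ c) (oddBinomialDensity r a (pushBit-<⁻¹ c K<)) ⟩
  powℚ ½ (bit c) ℚ.* powℚ ½ (w₂ a)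
    ≡⟨ powℚ-+ ½ (bit c) (w₂ a) ⟨
  powℚ ½ (bit c + w₂ a)
    ≡⟨ cong (powℚ ½) (w₂-pushBit c a) ⟨
  powℚ ½ (w₂ (pushBit c a)) ∎
  where
  odd : ℕ → ℚ
  odd n = toℚ (parity n)
  κ : ℚ
  κ = odd (0 C bit c) ℚ.+ odd (1 C bit c)
  S : ℚ
  S = sumTo (2 ^ r) (λ m → odd (m C a))
  digitSum : ∀ m → odd (pushBit false m C pushBit c a) ℚ.+ odd (pushBit true m C pushBit c a) ≡ κ ℚ.* odd (m C a)
  digitSum m = begin
    odd (pushBit false m C pushBit c a) ℚ.+ odd (pushBit true m C pushBit c a)
      ≡⟨ cong₂ ℚ._+_ (odd-pushBit false) (odd-pushBit true) ⟩
    odd (0 C bit c) ℚ.* odd (m C a) ℚ.+ odd (1 C bit c) ℚ.* odd (m C a)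
      ≡⟨ ℚ.*-distribʳ-+ (odd (m C a)) (odd (0 C bit c)) (odd (1 C bit c)) ⟨
    κ ℚ.* odd (m C a) ∎
    where
    odd-pushBit : ∀ b → odd (pushBit b m C pushBit c a) ≡ odd (bit b C bit c) ℚ.* odd (m C a)
    odd-pushBit b = trans (cong toℚ (parity-C-pushBit b m c a)) (toℚ-* (parity (bit b C bit c)) (parity (m C a)))
  ½*κ : ∀ c → ½ ℚ.* (odd (0 C bit c) ℚ.+ odd (1 C bit c)) ≡ powℚ ½ (bit c)
  ½*κ false = refl
  ½*κ true  = refl

-- Signed sums over sub-families

-- signedSubsetSum ks g = Σ_{I ⊆ ks} (-2)^|I| g (⋁ I)
signedSubsetSum : List ℕ → (ℕ → ℚ) → ℚ
signedSubsetSum []       g = g 0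
signedSubsetSum (k ∷ ks) g = signedSubsetSum ks g ℚ.+ ℚ.- two ℚ.* signedSubsetSum ks (λ x → g (k ∨ x))

layerSum : ℕ → List ℕ → (ℕ → ℚ) → ℚ
layerSum j ks g = Σℚ (map (λ I → g (⋁ I)) (choose j ks))

signedSubsetSum-cong : ∀ ks {g h} → (∀ x → g x ≡ h x) → signedSubsetSum ks g ≡ signedSubsetSum ks h
signedSubsetSum-cong []       g≗h = g≗h 0
signedSubsetSum-cong (k ∷ ks) g≗h = cong₂ (λ u v → u ℚ.+ ℚ.- two ℚ.* v)
  (signedSubsetSum-cong ks g≗h) (signedSubsetSum-cong ks (λ x → g≗h (k ∨ x)))

signedSubsetSum-cong-< : ∀ r ks {g h} → All (_< 2 ^ r) ks → (∀ x → x < 2 ^ r → g x ≡ h x) →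
  signedSubsetSum ks g ≡ signedSubsetSum ks h
signedSubsetSum-cong-< r []       []           g≗h = g≗h 0 (m^n>0 2 r)
signedSubsetSum-cong-< r (k ∷ ks) (k< ∷ ks<) g≗h = cong₂ (λ u v → u ℚ.+ ℚ.- two ℚ.* v)
  (signedSubsetSum-cong-< r ks ks< g≗h)
  (signedSubsetSum-cong-< r ks ks< (λ x x< → g≗h (k ∨ x) (∨-<-2^ r k< x<)))

*-distribˡ-signedSubsetSum : ∀ ks c g → c ℚ.* signedSubsetSum ks g ≡ signedSubsetSum ks (λ x → c ℚ.* g x)
*-distribˡ-signedSubsetSum []       c g = refl
*-distribˡ-signedSubsetSum (k ∷ ks) c g = begin
  c ℚ.* (U g ℚ.+ ℚ.- two ℚ.* U gₖ)
    ≡⟨ solve 4 (λ c u t v → c :* (u :+ t :* v) := c :* u :+ t :* (c :* v)) refl c (U g) (ℚ.- two) (U gₖ) ⟩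
  c ℚ.* U g ℚ.+ ℚ.- two ℚ.* (c ℚ.* U gₖ)
    ≡⟨ cong₂ (λ u v → u ℚ.+ ℚ.- two ℚ.* v)
         (*-distribˡ-signedSubsetSum ks c g) (*-distribˡ-signedSubsetSum ks c gₖ) ⟩
  signedSubsetSum (k ∷ ks) (λ x → c ℚ.* g x) ∎
  where
  U : (ℕ → ℚ) → ℚ
  U = signedSubsetSum ks
  gₖ : ℕ → ℚ
  gₖ = λ x → g (k ∨ x)

sumTo-signedSubsetSum : ∀ n ks (g : ℕ → ℕ → ℚ) →
  sumTo n (λ m → signedSubsetSum ks (g m)) ≡ signedSubsetSum ks (λ x → sumTo n (λ m → g m x))
sumTo-signedSubsetSum n []       g = refl
sumTo-signedSubsetSum n (k ∷ ks) g = begin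
  sumTo n (λ m → signedSubsetSum ks (g m) ℚ.+ ℚ.- two ℚ.* signedSubsetSum ks (λ x → g m (k ∨ x)))
    ≡⟨ sumTo-distrib-+ n _ _ ⟩
  sumTo n (λ m → signedSubsetSum ks (g m)) ℚ.+ sumTo n (λ m → ℚ.- two ℚ.* signedSubsetSum ks (λ x → g m (k ∨ x)))
    ≡⟨ cong (sumTo n (λ m → signedSubsetSum ks (g m)) ℚ.+_) (*-distribˡ-sumTo n (ℚ.- two) _) ⟨
  sumTo n (λ m → signedSubsetSum ks (g m)) ℚ.+ ℚ.- two ℚ.* sumTo n (λ m → signedSubsetSum ks (λ x → g m (k ∨ x)))
    ≡⟨ cong₂ (λ u v → u ℚ.+ ℚ.- two ℚ.* v)
         (sumTo-signedSubsetSum n ks g) (sumTo-signedSubsetSum n ks (λ m x → g m (k ∨ x))) ⟩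
  signedSubsetSum (k ∷ ks) (λ x → sumTo n (λ m → g m x)) ∎

choose-length : ∀ j ks → length ks < j → choose j ks ≡ []
choose-length (suc j) []       _ = refl
choose-length (suc j) (k ∷ ks) (s≤s |ks|<j)
  rewrite choose-length j ks |ks|<j | choose-length (suc j) ks (<-trans |ks|<j (n<1+n j)) = refl

layerSum-∷ : ∀ j k ks g → layerSum (suc j) (k ∷ ks) g ≡ layerSum j ks (λ x → g (k ∨ x)) ℚ.+ layerSum (suc j) ks g
layerSum-∷ j k ks g = begin
  Σℚ (map G (map (k ∷_) (choose j ks) ++ choose (suc j) ks))
    ≡⟨ cong Σℚ (List.map-++ G (map (k ∷_) (choose j ks)) (choose (suc j) ks)) ⟩
  Σℚ (map G (map (k ∷_) (choose j ks)) ++ map G (choose (suc j) ks))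
    ≡⟨ Σℚ-++ (map G (map (k ∷_) (choose j ks))) (map G (choose (suc j) ks)) ⟩
  Σℚ (map G (map (k ∷_) (choose j ks))) ℚ.+ layerSum (suc j) ks g
    ≡⟨ cong (λ xs → Σℚ xs ℚ.+ layerSum (suc j) ks g) (List.map-∘ (choose j ks)) ⟨
  layerSum j ks (λ x → g (k ∨ x)) ℚ.+ layerSum (suc j) ks g ∎
  where
  G : List ℕ → ℚ
  G = λ I → g (⋁ I)

signedSubsetSum≡layerSums : ∀ ks g →
  signedSubsetSum ks g ≡ sumTo (suc (length ks)) (λ j → powℚ (ℚ.- two) j ℚ.* layerSum j ks g)
signedSubsetSum≡layerSums []       g = solve 1 (λ a → a := con 1ℚ :* (a :+ con 0ℚ) :+ con 0ℚ) refl (g 0)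
signedSubsetSum≡layerSums (k ∷ ks) g = begin
  signedSubsetSum ks g ℚ.+ ℚ.- two ℚ.* signedSubsetSum ks gₖ
    ≡⟨ cong₂ (λ u v → u ℚ.+ ℚ.- two ℚ.* v) (signedSubsetSum≡layerSums ks g) (signedSubsetSum≡layerSums ks gₖ) ⟩
  A 0 ℚ.+ sumTo n (λ j → A (suc j)) ℚ.+ ℚ.- two ℚ.* sumTo (suc n) Aₖ
    ≡⟨ cong (λ z → A 0 ℚ.+ z ℚ.+ ℚ.- two ℚ.* sumTo (suc n) Aₖ) (sumTo-suc-vanishing n (λ j → A (suc j)) topLayer) ⟨
  A 0 ℚ.+ sumTo (suc n) (λ j → A (suc j)) ℚ.+ ℚ.- two ℚ.* sumTo (suc n) Aₖ
    ≡⟨ cong (A 0 ℚ.+ sumTo (suc n) (λ j → A (suc j)) ℚ.+_) (*-distribˡ-sumTo (suc n) (ℚ.- two) Aₖ) ⟩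
  A 0 ℚ.+ sumTo (suc n) (λ j → A (suc j)) ℚ.+ sumTo (suc n) (λ j → ℚ.- two ℚ.* Aₖ j)
    ≡⟨ ℚ.+-assoc (A 0) _ _ ⟩
  A 0 ℚ.+ (sumTo (suc n) (λ j → A (suc j)) ℚ.+ sumTo (suc n) (λ j → ℚ.- two ℚ.* Aₖ j))
    ≡⟨ cong (A 0 ℚ.+_) (sumTo-distrib-+ (suc n) (λ j → A (suc j)) (λ j → ℚ.- two ℚ.* Aₖ j)) ⟨
  A 0 ℚ.+ sumTo (suc n) (λ j → A (suc j) ℚ.+ ℚ.- two ℚ.* Aₖ j)
    ≡⟨ cong (A 0 ℚ.+_) (sumTo-cong (suc n) layerStep) ⟩
  sumTo (suc (suc n)) (λ j → powℚ (ℚ.- two) j ℚ.* layerSum j (k ∷ ks) g) ∎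
  where
  n : ℕ
  n = length ks
  gₖ : ℕ → ℚ
  gₖ = λ x → g (k ∨ x)
  A Aₖ : ℕ → ℚ
  A = λ j → powℚ (ℚ.- two) j ℚ.* layerSum j ks g
  Aₖ = λ j → powℚ (ℚ.- two) j ℚ.* layerSum j ks gₖ
  topLayer : A (suc n) ≡ 0ℚ
  topLayer = trans (cong (λ Is → powℚ (ℚ.- two) (suc n) ℚ.* Σℚ (map (λ I → g (⋁ I)) Is))
                         (choose-length (suc n) ks ≤-refl))
                   (ℚ.*-zeroʳ (powℚ (ℚ.- two) (suc n)))
  layerStep : ∀ j → A (suc j) ℚ.+ ℚ.- two ℚ.* Aₖ j ≡ powℚ (ℚ.- two) (suc j) ℚ.* layerSum (suc j) (k ∷ ks) g
  layerStep j = begin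
    A (suc j) ℚ.+ ℚ.- two ℚ.* Aₖ j
      ≡⟨ solve 4 (λ t p a b → t :* p :* b :+ t :* (p :* a) := t :* p :* (a :+ b)) refl
           (ℚ.- two) (powℚ (ℚ.- two) j) (layerSum j ks gₖ) (layerSum (suc j) ks g) ⟩
    powℚ (ℚ.- two) (suc j) ℚ.* (layerSum j ks gₖ ℚ.+ layerSum (suc j) ks g)
      ≡⟨ cong (powℚ (ℚ.- two) (suc j) ℚ.*_) (layerSum-∷ j k ks g) ⟨
    powℚ (ℚ.- two) (suc j) ℚ.* layerSum (suc j) (k ∷ ks) g ∎

sgn-sum-C : ∀ m ks → sgn (sum (map (m C_) ks)) ≡ signedSubsetSum ks (λ x → toℚ (parity (m C x)))
sgn-sum-C m []       = refl
sgn-sum-C m (k ∷ ks) = begin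
  sgn (m C k + sum (map (m C_) ks))
    ≡⟨ sgn-+ (m C k) _ ⟩
  sgn (m C k) ℚ.* sgn (sum (map (m C_) ks))
    ≡⟨ cong₂ ℚ._*_ (trans (sgn≡sign∘parity (m C k)) (sign≡1-2toℚ (parity (m C k)))) (sgn-sum-C m ks) ⟩
  (1ℚ ℚ.+ ℚ.- two ℚ.* oₖ) ℚ.* U o
    ≡⟨ solve 3 (λ t a u → (con 1ℚ :+ t :* a) :* u := u :+ t :* (a :* u)) refl (ℚ.- two) oₖ (U o) ⟩
  U o ℚ.+ ℚ.- two ℚ.* (oₖ ℚ.* U o)
    ≡⟨ cong (λ z → U o ℚ.+ ℚ.- two ℚ.* z) (*-distribˡ-signedSubsetSum ks oₖ o) ⟩
  U o ℚ.+ ℚ.- two ℚ.* U (λ x → oₖ ℚ.* o x)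
    ≡⟨ cong (λ z → U o ℚ.+ ℚ.- two ℚ.* z) (signedSubsetSum-cong ks (λ x →
         trans (sym (toℚ-* (parity (m C k)) (parity (m C x)))) (cong toℚ (sym (parity-C-∨ m k x))))) ⟩
  signedSubsetSum (k ∷ ks) o ∎
  where
  U : (ℕ → ℚ) → ℚ
  U = signedSubsetSum ks
  o : ℕ → ℚ
  o = λ x → toℚ (parity (m C x))
  oₖ : ℚ
  oₖ = o k

c₀≡signedSubsetSum : ∀ ks → c₀ ks ≡
  signedSubsetSum (toList ks) (λ x → powℚ ½ (rOf ks) ℚ.* sumTo (2 ^ rOf ks) (λ m → toℚ (parity (m C x))))
c₀≡signedSubsetSum ks = begin
  ½ʳ ℚ.* Σℚ (map (λ m → sgn (sum (map (m C_) L))) (upTo N))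
    ≡⟨ cong (½ʳ ℚ.*_) (Σℚ-map-applyUpTo N _ (λ m → m)) ⟩
  ½ʳ ℚ.* sumTo N (λ m → sgn (sum (map (m C_) L)))
    ≡⟨ cong (½ʳ ℚ.*_) (sumTo-cong N (λ m → sgn-sum-C m L)) ⟩
  ½ʳ ℚ.* sumTo N (λ m → signedSubsetSum L (λ x → toℚ (parity (m C x))))
    ≡⟨ cong (½ʳ ℚ.*_) (sumTo-signedSubsetSum N L (λ m x → toℚ (parity (m C x)))) ⟩
  ½ʳ ℚ.* signedSubsetSum L (λ x → sumTo N (λ m → toℚ (parity (m C x))))
    ≡⟨ *-distribˡ-signedSubsetSum L ½ʳ _ ⟩
  signedSubsetSum L (λ x → ½ʳ ℚ.* sumTo N (λ m → toℚ (parity (m C x)))) ∎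
  where
  L : List ℕ
  L = toList ks
  N : ℕ
  N = 2 ^ rOf ks
  ½ʳ : ℚ
  ½ʳ = powℚ ½ (rOf ks)

rhs≡layerSums : ∀ ks →
  rhs ks ≡ sumTo (suc (length (toList ks))) (λ j → powℚ (ℚ.- two) j ℚ.* layerSum j (toList ks) (λ x → powℚ ½ (w₂ x)))
-- The j = 0 layer 1ℚ ℚ.* (powℚ ½ (w₂ 0) ℚ.+ 0ℚ) reduces to the leading 1ℚ of rhs.
rhs≡layerSums ks = cong (1ℚ ℚ.+_) (begin
  Σℚ (map term (map suc (upTo s)))   ≡⟨ cong Σℚ (List.map-∘ {g = term} {f = suc} (upTo s)) ⟨
  Σℚ (map (λ j → term (suc j)) (upTo s)) ≡⟨ Σℚ-map-applyUpTo s (λ j → term (suc j)) (λ j → j) ⟩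
  sumTo s (λ j → term (suc j))       ≡⟨ sumTo-cong s (λ j → term≡layer (suc j)) ⟩
  sumTo s (λ j → powℚ (ℚ.- two) (suc j) ℚ.* layerSum (suc j) L h) ∎)
  where
  L : List ℕ
  L = toList ks
  s : ℕ
  s = length L
  h : ℕ → ℚ
  h = λ x → powℚ ½ (w₂ x)
  term : ℕ → ℚ
  term j = sgn j ℚ.* Σℚ (map (λ I → pow2 (ℤ.+ j ℤ.- ℤ.+ w₂ (⋁ I))) (choose j L))
  term≡layer : ∀ j → term j ≡ powℚ (ℚ.- two) j ℚ.* layerSum j L h
  term≡layer j = begin
    sgn j ℚ.* Σℚ (map (λ I → pow2 (ℤ.+ j ℤ.- ℤ.+ w₂ (⋁ I))) (choose j L))
      ≡⟨ cong (λ xs → sgn j ℚ.* Σℚ xs) (List.map-cong (λ I → pow2-∸ j (w₂ (⋁ I))) (choose j L)) ⟩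
    sgn j ℚ.* Σℚ (map (λ I → powℚ two j ℚ.* h (⋁ I)) (choose j L))
      ≡⟨ cong (sgn j ℚ.*_) (*-distribˡ-Σℚ-map (powℚ two j) (λ I → h (⋁ I)) (choose j L)) ⟨
    sgn j ℚ.* (powℚ two j ℚ.* layerSum j L h)
      ≡⟨ ℚ.*-assoc (sgn j) (powℚ two j) (layerSum j L h) ⟨
    sgn j ℚ.* powℚ two j ℚ.* layerSum j L h
      ≡⟨ cong (ℚ._* layerSum j L h) (sgn-*-two^ j) ⟩
    powℚ (ℚ.- two) j ℚ.* layerSum j L h ∎

toList-∷ʳ : ∀ {A : Set} xs (y : A) → toList (xs List⁺.∷ʳ y) ≡ xs List.∷ʳ y
toList-∷ʳ []       y = refl
toList-∷ʳ (x ∷ xs) y = refl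

sorted⇒<2^rOf : ∀ ks → AllPairs _<_ (toList ks) → All (_< 2 ^ rOf ks) (toList ks)
sorted⇒<2^rOf ks sorted with List⁺.snocView ks
... | xs ∷ʳ′ y rewrite toList-∷ʳ xs y =
  All.∷ʳ⁺ (All.map (λ x<y → <-trans x<y y<2^r) (<-last xs sorted)) y<2^r
  where
  y<2^r : y < 2 ^ suc ⌊log₂ y ⌋
  y<2^r = n<2^[1+⌊log₂n⌋] y
  <-last : ∀ xs {y} → AllPairs _<_ (xs List.∷ʳ y) → All (_< y) xs
  <-last []       _             = []
  <-last (x ∷ xs) (x<xs ∷ xs<) = proj₂ (All.∷ʳ⁻ x<xs) ∷ <-last xs xs<

mainTheorem9 : (ks : List⁺ ℕ) → All (1 ≤_) (toList ks) → AllPairs _<_ (toList ks) →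
    c₀ ks ≡ rhs ks
mainTheorem9 ks _ sorted = begin
  c₀ ks
    ≡⟨ c₀≡signedSubsetSum ks ⟩
  signedSubsetSum L (λ x → powℚ ½ r ℚ.* sumTo (2 ^ r) (λ m → toℚ (parity (m C x))))
    ≡⟨ signedSubsetSum-cong-< r L (sorted⇒<2^rOf ks sorted) (oddBinomialDensity r) ⟩
  signedSubsetSum L (λ x → powℚ ½ (w₂ x))
    ≡⟨ signedSubsetSum≡layerSums L _ ⟩
  sumTo (suc (length L)) (λ j → powℚ (ℚ.- two) j ℚ.* layerSum j L (λ x → powℚ ½ (w₂ x)))
    ≡⟨ rhs≡layerSums ks ⟨
  rhs ks ∎
  where
  L : List ℕ
  L = toList ks
  r : ℕ
  r = rOf ks
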